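{- Let $A,B,C$ be strings with $|\mathit{RLE}(C)|=1$, $|A|=M$, $|B|=N$. Let $G(1),\ldots,G(g)$ be the equivalence classes of minimal $C$-intervals of $A$ and $G'(1),\ldots,G'(g')$ those of $B$, as defined below. For any $1\le h\le g$ and $1\le h'\le g'$, if $[s,f],[s+d,f+d]\in G(h)$ and $[s',f'],[s'+d,f'+d]\in G'(h')$ for some positive integer $d$, then \[L^{pref}(s-1,s'-1)+L^{suf}(f+1,f'+1)=L^{pref}(s+d-1,s'+d-1)+L^{suf}(f+d+1,f'+d+1).\]
   Context: A subsequence of a string is obtained by deleting zero or more characters. $L^{pref}(i,j)$ is the length of a longest common subsequence of $A[1..i]$ and $B[1..j]$, and $L^{suf}(i,j)$ the length of a longest common subsequence of $A[i..M]$ and $B[j..N]$ (with empty prefixes/suffixes giving value $0$). An interval $[s,f]$ is a minimal $C$-interval of $A$ if $C$ is a subsequence of $A[s..f]$ but not of $A[s+1..f]$ nor of $A[s..f-1]$. With $\mathit{RLE}(A)=a_1^{M_1}\cdots a_m^{M_m}$ (maximal runs), $M_{1..p}=M_1+\cdots+M_p$, $M_{1..0}=0$, two minimal $C$-intervals $[s_x,f_x],[s_y,f_y]$ of $A$ are equivalent iff there are $1\le p\le q\le m$ with $M_{1..p-1}<s_x,s_y\le M_{1..p}$ and $M_{1..q-1}<f_x,f_y\le M_{1..q}$ (same starting run and same ending run); $G(1),\ldots,G(g)$ are the equivalence classes. $G'(1),\ldots,G'(g')$ are defined analogously for $B$ using the runs of $B$. $|\mathit{RLE}(C)|=1$ means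 $C$ consists of a single repeated character. -}

module Defs where

open import Data.Nat using (ℕ; zero; suc; _+_; _∸_; _≤_; _<_)
open import Data.List using (List; []; _∷_; take; drop; length; map; concatMap; replicate)
open import Data.List.Relation.Binary.Sublist.Propositional using (_⊆_)
open import Data.Product using (Σ; _×_; _,_; proj₁; proj₂; ∃; ∃-syntax)
open import Data.Nat.ListAction using (sum)
open import Data.Unit using (⊤)
open import Relation.Nullary using (¬_)
open import Relation.Binary.PropositionalEquality using (_≡_)

-- Strings over an arbitrary alphabet S are lists; positions are 1-based.

Subseq : {S : Set} → List S → List S → Set
Subseq X Y = X ⊆ Y

-- A[i..j] (1-based, inclusive); empty when j < i
substr : {S : Set} → List S → ℕ → ℕ → List S
substr A i j = take ((j + 1) ∸ i) (drop (i ∸ 1) A)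

prefix : {S : Set} → List S → ℕ → List S
prefix A i = take i A

suffix : {S : Set} → List S → ℕ → List S
suffix A i = drop (i ∸ 1) A

IsLCS : {S : Set} → List S → List S → ℕ → Set
IsLCS {S} X Y k =
  (Σ (List S) λ Z → Subseq Z X × Subseq Z Y × length Z ≡ k)
  × ((Z : List S) → Subseq Z X → Subseq Z Y → length Z ≤ k)

Lpref : {S : Set} → List S → List S → ℕ → ℕ → ℕ → Set
Lpref A B i j k = IsLCS (prefix A i) (prefix B j) k

Lsuf : {S : Set} → List S → List S → ℕ → ℕ → ℕ → Set
Lsuf A B i j k = IsLCS (suffix A i) (suffix B j) k

MinimalInterval : {S : Set} → List S → List S → ℕ → ℕ → Set
MinimalInterval C A s f =
  1 ≤ s × s ≤ f × f ≤ length A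
  × Subseq C (substr A s f)
  × ¬ Subseq C (substr A (suc s) f)
  × ¬ Subseq C (substr A s (f ∸ 1))

-- Run-length encoding: a list of (character, run length)
expand : {S : Set} → List (S × ℕ) → List S
expand = concatMap (λ r → replicate (proj₂ r) (proj₁ r))

AdjDistinct : {S : Set} → List (S × ℕ) → Set
AdjDistinct [] = ⊤
AdjDistinct (r ∷ []) = ⊤
AdjDistinct (r ∷ r' ∷ rs) = ¬ (proj₁ r ≡ proj₁ r') × AdjDistinct (r' ∷ rs)

AllPos : {S : Set} → List (S × ℕ) → Set
AllPos [] = ⊤
AllPos (r ∷ rs) = 1 ≤ proj₂ r × AllPos rs

IsRLE : {S : Set} → List S → List (S × ℕ) → Set
IsRLE A rle = expand rle ≡ A × AllPos rle × AdjDistinct rle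

runPrefixSum : {S : Set} → List (S × ℕ) → ℕ → ℕ
runPrefixSum rle p = sum (map proj₂ (take p rle))

EquivIntervals : {S : Set} → List (S × ℕ) → ℕ → ℕ → ℕ → ℕ → Set
EquivIntervals rle sx fx sy fy =
  ∃[ p ] ∃[ q ]
    (1 ≤ p × p ≤ q × q ≤ length rle
    × runPrefixSum rle (p ∸ 1) < sx × sx ≤ runPrefixSum rle p
    × runPrefixSum rle (p ∸ 1) < sy × sy ≤ runPrefixSum rle p
    × runPrefixSum rle (q ∸ 1) < fx × fx ≤ runPrefixSum rle q
    × runPrefixSum rle (q ∸ 1) < fy × fy ≤ runPrefixSum rle q)

-- Since C = c^k, both endpoints of a minimal C-interval [s,f] of A carry the letter c.
-- As s, s+d lie in one run of A (and so do f, f+d), A[s..s+d] and A[f..f+d] are runs of c.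
-- Hence A[1..s+d-1] = A[1..s-1] c^d and A[f+1..M] = c^d A[f+d+1..M], and likewise in B.
-- A common prefix or suffix Z adds exactly |Z| to the LCS length, so
-- L^pref(s+d-1,s'+d-1) = L^pref(s-1,s'-1) + d and L^suf(f+1,f'+1) = d + L^suf(f+d+1,f'+d+1).
module Submission where

open import Defs
open import Data.Nat using (ℕ; zero; suc; _+_; _∸_; _≤_; z≤n; s≤s; s≤s⁻¹)
open import Data.Nat.Properties
open import Data.List using (List; []; _∷_; _++_; [_]; take; drop; length; replicate; reverse)
open import Data.List.Properties
  using (reverse-++; reverse-involutive; length-reverse; length-replicate; ++-identityʳ; ∷-injective; drop-drop; take-[]; take++drop≡id)
open import Data.List.Relation.Binary.Sublist.Heterogeneous using (_∷ʳ_; _∷_)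
import Data.List.Relation.Binary.Sublist.Heterogeneous.Properties as Sublist
open import Data.List.Relation.Binary.Sublist.Propositional using (_⊆_)
open import Data.List.Relation.Unary.All as All using (All)
open import Data.List.Relation.Unary.All.Properties using (++⁺; replicate⁺)
open import Data.List.Relation.Unary.Any using (here; there)
open import Data.List.Membership.Propositional using (_∈_)
open import Data.Product using (Σ; _×_; _,_; ∃-syntax)
open import Data.Empty using (⊥-elim)
open import Relation.Nullary using (¬_)
open import Relation.Binary.PropositionalEquality hiding ([_])

module _ {S : Set} where

  IsLCS-resp : ∀ {X X' Y Y' : List S} {k k'} → X ≡ X' → Y ≡ Y' → k ≡ k' → IsLCS X Y k → IsLCS X' Y' k'
  IsLCS-resp refl refl refl h = h

  IsLCS-unique : ∀ {X Y : List S} {k k'} → IsLCS X Y k → IsLCS X Y k' → k ≡ k'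
  IsLCS-unique ((Z , Z⊆X , Z⊆Y , refl) , max) ((Z' , Z'⊆X , Z'⊆Y , refl) , max') =
    ≤-antisym (max' Z Z⊆X Z⊆Y) (max Z' Z'⊆X Z'⊆Y)

  IsLCS-∷ : ∀ (c : S) {X Y k} → IsLCS X Y k → IsLCS (c ∷ X) (c ∷ Y) (suc k)
  IsLCS-∷ c {X} {Y} {k} ((Z , Z⊆X , Z⊆Y , refl) , max) = (c ∷ Z , refl ∷ Z⊆X , refl ∷ Z⊆Y , refl) , max′
    where
    max′ : (W : List S) → W ⊆ c ∷ X → W ⊆ c ∷ Y → length W ≤ suc k
    max′ []      _   _   = z≤n
    max′ (_ ∷ W) W⊆X W⊆Y = s≤s (max W (Sublist.∷⁻ W⊆X) (Sublist.∷⁻ W⊆Y))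

  IsLCS-++ˡ : ∀ (Z : List S) {X Y k} → IsLCS X Y k → IsLCS (Z ++ X) (Z ++ Y) (length Z + k)
  IsLCS-++ˡ []      h = h
  IsLCS-++ˡ (c ∷ Z) h = IsLCS-∷ c (IsLCS-++ˡ Z h)

  IsLCS-reverse : ∀ {X Y : List S} {k} → IsLCS X Y k → IsLCS (reverse X) (reverse Y) k
  IsLCS-reverse {X} {Y} {k} ((Z , Z⊆X , Z⊆Y , refl) , max) =
    (reverse Z , Sublist.reverse⁺ Z⊆X , Sublist.reverse⁺ Z⊆Y , length-reverse Z) , max′
    where
    reverse⁻′ : ∀ {W V : List S} → W ⊆ reverse V → reverse W ⊆ V
    reverse⁻′ {W} W⊆V = Sublist.reverse⁻ (subst (_⊆ _) (sym (reverse-involutive W)) W⊆V)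
    max′ : (W : List S) → W ⊆ reverse X → W ⊆ reverse Y → length W ≤ k
    max′ W W⊆X W⊆Y = subst (_≤ k) (length-reverse W) (max (reverse W) (reverse⁻′ W⊆X) (reverse⁻′ W⊆Y))

  IsLCS-++ʳ : ∀ (Z : List S) {X Y k} → IsLCS X Y k → IsLCS (X ++ Z) (Y ++ Z) (length Z + k)
  IsLCS-++ʳ Z {X} {Y} h =
    IsLCS-resp (reverse-involutive (X ++ Z)) (reverse-involutive (Y ++ Z)) refl
      (IsLCS-reverse (IsLCS-resp (sym (reverse-++ X Z)) (sym (reverse-++ Y Z)) (cong (_+ _) (length-reverse Z))
        (IsLCS-++ˡ (reverse Z) (IsLCS-reverse h))))

  drop-suc-tail : ∀ (X : List S) i {a R} → drop i X ≡ a ∷ R → drop (suc i) X ≡ R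
  drop-suc-tail []      zero    ()
  drop-suc-tail []      (suc i) ()
  drop-suc-tail (x ∷ X) zero    refl = refl
  drop-suc-tail (x ∷ X) (suc i) eq   = drop-suc-tail X i eq

  take-suc-++ : ∀ (X : List S) i {a R} → drop i X ≡ a ∷ R → take (suc i) X ≡ take i X ++ [ a ]
  take-suc-++ []      zero    ()
  take-suc-++ []      (suc i) ()
  take-suc-++ (x ∷ X) zero    refl = refl
  take-suc-++ (x ∷ X) (suc i) eq   = cong (x ∷_) (take-suc-++ X i eq)

  take-+ : ∀ (X : List S) i d → take (i + d) X ≡ take i X ++ take d (drop i X)
  take-+ X       zero    d = refl
  take-+ []      (suc i) d = sym (take-[] d)
  take-+ (x ∷ X) (suc i) d = cong (x ∷_) (take-+ X i d)

  take-replicate-pred : ∀ (X : List S) d {a} → take (suc d) X ≡ replicate (suc d) a → take d X ≡ replicate d a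
  take-replicate-pred X       zero    _ = refl
  take-replicate-pred []      (suc d) ()
  take-replicate-pred (x ∷ X) (suc d) eq with ∷-injective eq
  ... | refl , eq′ = cong (x ∷_) (take-replicate-pred X d eq′)

  take-replicate-head : ∀ (X : List S) d {a} → take (suc d) X ≡ replicate (suc d) a →
    Σ (List S) λ R → X ≡ a ∷ R × take d R ≡ replicate d a
  take-replicate-head []      d ()
  take-replicate-head (x ∷ R) d eq with ∷-injective eq
  ... | refl , eq′ = R , refl , eq′

  drop-+-replicate : ∀ (a : S) n j X → drop (n + j) (replicate n a ++ X) ≡ drop j X
  drop-+-replicate a zero    j X = refl
  drop-+-replicate a (suc n) j X = drop-+-replicate a n j X

  take-drop-replicate : ∀ (a : S) n i m X → i + m ≤ n → take m (drop i (replicate n a ++ X)) ≡ replicate m a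
  take-drop-replicate a n       zero    zero    X _          = refl
  take-drop-replicate a (suc n) zero    (suc m) X (s≤s m≤n)  = cong (a ∷_) (take-drop-replicate a n zero m X m≤n)
  take-drop-replicate a (suc n) (suc i) m       X (s≤s im≤n) = take-drop-replicate a n i m X im≤n

  -- Positions i+1, ..., i+d+1 (1-based) all lie in run number p+1.
  expand-window : (rle : List (S × ℕ)) (p i d : ℕ) →
    runPrefixSum rle p ≤ i → i + suc d ≤ runPrefixSum rle (suc p) →
    ∃[ a ] take (suc d) (drop i (expand rle)) ≡ replicate (suc d) a
  expand-window [] p i d _ hi = ⊥-elim (<⇒≱ (s≤s z≤n) (subst (_≤ 0) (+-suc i d) hi))
  expand-window ((a , n) ∷ rle) zero i d _ hi =
    a , take-drop-replicate a n i (suc d) (expand rle) (subst (i + suc d ≤_) (+-identityʳ n) hi)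
  expand-window ((a , n) ∷ rle) (suc p) i d lo hi with m≤n⇒∃[o]m+o≡n (≤-trans (m≤m+n n _) lo)
  ... | j , refl with expand-window rle p j d (+-cancelˡ-≤ n _ _ lo)
                        (+-cancelˡ-≤ n _ _ (subst (_≤ n + runPrefixSum rle (suc p)) (+-assoc n j (suc d)) hi))
  ... | b , window = b , trans (cong (take (suc d)) (drop-+-replicate a n j (expand rle))) window

  head-∈ : ∀ {C T : List S} {a} → C ⊆ a ∷ T → ¬ C ⊆ T → a ∈ C
  head-∈ (_ ∷ʳ C⊆T) C⊈T = ⊥-elim (C⊈T C⊆T)
  head-∈ (refl ∷ _) _   = here refl

  last-∈ : ∀ {C : List S} T {a} → C ⊆ T ++ [ a ] → ¬ C ⊆ T → a ∈ C
  last-∈ []      (_ ∷ʳ C⊆T) C⊈T = ⊥-elim (C⊈T C⊆T)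
  last-∈ []      (refl ∷ _)  _   = here refl
  last-∈ (x ∷ T) (_ ∷ʳ C⊆T) C⊈T = last-∈ T C⊆T (λ C⊆T′ → C⊈T (x ∷ʳ C⊆T′))
  last-∈ (x ∷ T) (refl ∷ C⊆T) C⊈T = there (last-∈ T C⊆T (λ C⊆T′ → C⊈T (refl ∷ C⊆T′)))

  -- substr A (suc s) (suc f) = take ((f + 1) ∸ s) (drop s A), a window of length suc (f ∸ s).
  window-length : ∀ {s f} → s ≤ f → (f + 1) ∸ s ≡ suc (f ∸ s)
  window-length {s} {f} s≤f = trans (+-∸-comm 1 s≤f) (+-comm (f ∸ s) 1)

  substr-pred-length : ∀ s f → (f + 1) ∸ suc s ≡ f ∸ s
  substr-pred-length s f = cong (_∸ suc s) (+-comm f 1)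

  substr-start : ∀ (A : List S) s f {a R} → s ≤ f → drop s A ≡ a ∷ R →
    substr A (suc s) (suc f) ≡ a ∷ substr A (suc (suc s)) (suc f)
  substr-start A s f {a} {R} s≤f eq = begin
    take ((f + 1) ∸ s) (drop s A)            ≡⟨ cong₂ take (window-length s≤f) eq ⟩
    a ∷ take (f ∸ s) R                       ≡⟨ cong₂ (λ m X → a ∷ take m X) (sym (substr-pred-length s f))
                                                   (sym (drop-suc-tail A s eq)) ⟩
    a ∷ take ((f + 1) ∸ suc s) (drop (suc s) A) ∎
    where open ≡-Reasoning

  substr-end : ∀ (A : List S) s f {a R} → s ≤ f → drop f A ≡ a ∷ R →
    substr A (suc s) (suc f) ≡ substr A (suc s) f ++ [ a ]
  substr-end A s f {a} s≤f eq = begin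
    take ((f + 1) ∸ s) (drop s A)       ≡⟨ cong (λ m → take m (drop s A)) (window-length s≤f) ⟩
    take (suc (f ∸ s)) (drop s A)       ≡⟨ take-suc-++ (drop s A) (f ∸ s) drop-f ⟩
    take (f ∸ s) (drop s A) ++ [ a ]      ≡⟨ cong (λ m → take m (drop s A) ++ [ a ]) (sym (substr-pred-length s f)) ⟩
    take ((f + 1) ∸ suc s) (drop s A) ++ [ a ] ∎
    where
    open ≡-Reasoning
    drop-f : drop (f ∸ s) (drop s A) ≡ a ∷ _
    drop-f = trans (drop-drop s (f ∸ s) A) (trans (cong (λ m → drop m A) (m+[n∸m]≡n s≤f)) eq)

  minimal-start-∈ : ∀ {C A : List S} {s f a R} → MinimalInterval C A (suc s) (suc f) → drop s A ≡ a ∷ R → a ∈ C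
  minimal-start-∈ {A = A} {s} {f} (_ , s≤f , _ , C⊆ , C⊈ , _) eq =
    head-∈ (subst (_ ⊆_) (substr-start A s f (s≤s⁻¹ s≤f) eq) C⊆) C⊈

  minimal-end-∈ : ∀ {C A : List S} {s f a R} → MinimalInterval C A (suc s) (suc f) → drop f A ≡ a ∷ R → a ∈ C
  minimal-end-∈ {A = A} {s} {f} (_ , s≤f , _ , C⊆ , _ , C⊈) eq =
    last-∈ (substr A (suc s) f) (subst (_ ⊆_) (substr-end A s f (s≤s⁻¹ s≤f) eq) C⊆) C⊈

  single-run-All : ∀ (rle : List (S × ℕ)) → length rle ≡ 1 → ∃[ c ] All (_≡ c) (expand rle)
  single-run-All ((c , k) ∷ []) _ = c , ++⁺ (replicate⁺ k refl) All.[]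

  -- The letters A[f+1], ..., A[f+d] share the run of the endpoint A[f] ∈ C.
  minimal-end-shift : ∀ {C A : List S} {rle c s f d} → All (_≡ c) C → IsRLE A rle →
    MinimalInterval C A s f → EquivIntervals rle s f (s + d) (f + d) →
    drop ((f + 1) ∸ 1) A ≡ replicate d c ++ drop (((f + d) + 1) ∸ 1) A
  minimal-end-shift {s = zero} _ _ (() , _) _
  minimal-end-shift {s = suc _} {zero} _ _ (_ , () , _) _
  minimal-end-shift {s = suc _} {suc _} _ _ _ (zero , _ , () , _)
  minimal-end-shift {s = suc _} {suc _} _ _ _ (suc _ , zero , _ , () , _)
  minimal-end-shift {A = A} {rle} {s = suc s} {suc f} {d} all-c (refl , _) mi
      (_ , suc q , _ , _ , _ , _ , _ , _ , _ , f-lo , _ , _ , f-hi)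
    with expand-window rle q f d (s≤s⁻¹ f-lo) (subst (_≤ runPrefixSum rle (suc q)) (sym (+-suc f d)) f-hi)
  ... | a , window with take-replicate-head (drop f A) d window
  ... | R , drop-f , take-R with All.lookup all-c (minimal-end-∈ mi drop-f)
  ... | refl = begin
    drop (f + 1) A                  ≡⟨ cong (λ m → drop m A) (+-comm f 1) ⟩
    drop (suc f) A                  ≡⟨ drop-suc-tail A f drop-f ⟩
    R                               ≡⟨ sym (take++drop≡id d R) ⟩
    take d R ++ drop d R            ≡⟨ cong₂ _++_ take-R (cong (drop d) (sym (drop-suc-tail A f drop-f))) ⟩
    replicate d a ++ drop d (drop (suc f) A) ≡⟨ cong (replicate d a ++_) (drop-drop (suc f) d A) ⟩
    replicate d a ++ drop (suc f + d) A      ≡⟨ cong (λ m → replicate d a ++ drop m A) (+-comm 1 (f + d)) ⟩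
    replicate d a ++ drop ((f + d) + 1) A ∎
    where open ≡-Reasoning

  -- The letters A[s+1], ..., A[s+d] share the run of the endpoint A[s] ∈ C.
  minimal-start-shift : ∀ {C A : List S} {rle c s f d} → All (_≡ c) C → IsRLE A rle →
    MinimalInterval C A s f → EquivIntervals rle s f (s + d) (f + d) →
    take ((s + d) ∸ 1) A ≡ take (s ∸ 1) A ++ replicate d c
  minimal-start-shift {s = zero} _ _ (() , _) _
  minimal-start-shift {s = suc _} {zero} _ _ (_ , () , _) _
  minimal-start-shift {s = suc _} {suc _} _ _ _ (zero , _ , () , _)
  minimal-start-shift {A = A} {rle} {s = suc s} {suc f} {d} all-c (refl , _) mi
      (suc p , _ , _ , _ , _ , s-lo , _ , _ , s-hi , _)
    with expand-window rle p s d (s≤s⁻¹ s-lo) (subst (_≤ runPrefixSum rle (suc p)) (sym (+-suc s d)) s-hi)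
  ... | a , window with take-replicate-head (drop s A) d window
  ... | _ , drop-s , _ with All.lookup all-c (minimal-start-∈ mi drop-s)
  ... | refl = trans (take-+ A s d) (cong (take s A ++_) (take-replicate-pred (drop s A) d window))

lemma13 : {S : Set} (A B C : List S) (rleA rleB rleC : List (S × ℕ)) →
          IsRLE A rleA → IsRLE B rleB → IsRLE C rleC → length rleC ≡ 1 →
          (s f s' f' d : ℕ) → 1 ≤ d →
          MinimalInterval C A s f → MinimalInterval C A (s + d) (f + d) →
          EquivIntervals rleA s f (s + d) (f + d) →
          MinimalInterval C B s' f' → MinimalInterval C B (s' + d) (f' + d) →
          EquivIntervals rleB s' f' (s' + d) (f' + d) →
          (l₁ l₂ l₃ l₄ : ℕ) →
          Lpref A B (s ∸ 1) (s' ∸ 1) l₁ → Lsuf A B (f + 1) (f' + 1) l₂ →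
          Lpref A B ((s + d) ∸ 1) ((s' + d) ∸ 1) l₃ →
          Lsuf A B ((f + d) + 1) ((f' + d) + 1) l₄ →
          l₁ + l₂ ≡ l₃ + l₄
lemma13 A B C rleA rleB rleC rA rB (refl , _) one-run s f s' f' d _ miA _ eqA miB _ eqB l₁ l₂ l₃ l₄ h₁ h₂ h₃ h₄
  with single-run-All rleC one-run
... | c , all-c = begin
  l₁ + l₂             ≡⟨ cong (l₁ +_) (sym l₂≡d+l₄) ⟩
  l₁ + (d + l₄)       ≡⟨ sym (+-assoc l₁ d l₄) ⟩
  l₁ + d + l₄         ≡⟨ cong (_+ l₄) (+-comm l₁ d) ⟩
  d + l₁ + l₄         ≡⟨ cong (_+ l₄) d+l₁≡l₃ ⟩
  l₃ + l₄             ∎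
  where
  open ≡-Reasoning
  d+l₁≡l₃ : d + l₁ ≡ l₃
  d+l₁≡l₃ = IsLCS-unique
    (IsLCS-resp (sym (minimal-start-shift all-c rA miA eqA)) (sym (minimal-start-shift all-c rB miB eqB))
      (cong (_+ l₁) (length-replicate d)) (IsLCS-++ʳ (replicate d c) h₁))
    h₃
  l₂≡d+l₄ : d + l₄ ≡ l₂
  l₂≡d+l₄ = IsLCS-unique
    (IsLCS-resp (sym (minimal-end-shift all-c rA miA eqA)) (sym (minimal-end-shift all-c rB miB eqB))
      (cong (_+ l₄) (length-replicate d)) (IsLCS-++ˡ (replicate d c) h₄))
    h₂
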